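{- Let $m$ be a positive integer, $k\in\mathbb N_0$ and $t\in\mathbb N$ with $k+t<2^m$. Then, over $\mathbb Z_2$: (1) $\kappa_t:=c_{k+t,t}\cdot(A_{k,t})^{ -1}\equiv \xi_t\pmod 2$; in particular $\kappa_t$ does not depend on $k$. (2) Let $v\ge 0$ be an integer with $8(v+1)\le 2^m-t$, and let $w$ be the column vector of length $2^m-t$ which consists of consecutive blocks: first $\overline{0}$, then $v$ copies of $\overline{1}$, then zeros (i.e. $w$ has entry $1$ exactly at positions $8s$, $s=1,\dots,v$, positions counted from $0$). Then $$\left(d_{k+t,t}-c_{k+t,t}\cdot(A_{k,t})^{ -1}B_{k,t}\right)\cdot w\equiv\binom{\lfloor (k+t)/8\rfloor+1+v}{v}+1\pmod 2.$$
   Context: For nonnegative integers $i,j$ let $p_{i,j}:=\binom{i+j}{j}\bmod 2$. Define the $t\times t$ matrix $A_{k,t}:=(p_{k+a,b})_{0\le a\le t-1,\ 0\le b\le t-1}$ (it is known that $A_{k,t}$ is invertible over $\mathbb Z_2$), the $t\times(2^m-t)$ matrix $B_{k,t}:=(p_{k+a,b})_{0\le a\le t-1,\ t\le b\le 2^m-1}$, the row vectors $c_{k+t,t}:=(p_{k+t,0},\dots,p_{k+t,t-1})$, $d_{k+t,t}:=(p_{k+t,t},\dots,p_{k+t,2^m-1})$, and $\xi_t:=\left(\binom{t}{0},\binom{t}{1},\dots,\binom{t}{t-1}\right)\bmod 2$. $\overline{0}=(0,0,0,0,0,0,0,0)^T$ and $\overline{1}=(1,0,0,0,0,0,0,0)^T$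 are column vectors of length $8$. -}

module Defs where

open import Data.Bool using (Bool; true; false; _∧_; _xor_)
open import Data.Nat using (ℕ; zero; suc; _+_; _*_; _%_; _/_; _≡ᵇ_; _≤ᵇ_)
open import Data.Nat.Combinatorics using (_C_)
open import Data.Fin using (Fin; toℕ; zero; suc)

-- ℤ₂ is modelled by Bool: addition = xor, multiplication = ∧.
Z₂ : Set
Z₂ = Bool

[_]₂ : ℕ → Z₂
[ n ]₂ = (n % 2) ≡ᵇ 1

p : ℕ → ℕ → Z₂
p i j = [ (i + j) C j ]₂

Σ₂ : ∀ n → (Fin n → Z₂) → Z₂
Σ₂ zero    f = false
Σ₂ (suc n) f = f zero xor Σ₂ n (λ i → f (suc i))

I : ∀ n → Fin n → Fin n → Z₂
I n i j = toℕ i ≡ᵇ toℕ j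

_⊗_ : ∀ {r s u} → (Fin r → Fin s → Z₂) → (Fin s → Fin u → Z₂) → Fin r → Fin u → Z₂
_⊗_ {s = s} M N i j = Σ₂ s (λ l → M i l ∧ N l j)

A : ℕ → (t : ℕ) → Fin t → Fin t → Z₂
A k t a b = p (k + toℕ a) (toℕ b)

-- B_{k,t} = (p_{k+a,b}), 0 ≤ a ≤ t-1, t ≤ b ≤ 2^m-1 ; column index j ↦ b = t + j
B : ℕ → (t : ℕ) → (n : ℕ) → Fin t → Fin n → Z₂
B k t n a j = p (k + toℕ a) (t + toℕ j)

c : ℕ → (t : ℕ) → Fin t → Z₂
c k t b = p (k + t) (toℕ b)

-- d_{k+t,t} = (p_{k+t,t},…,p_{k+t,2^m-1}) ; index j ↦ t + j
d : ℕ → (t : ℕ) → (n : ℕ) → Fin n → Z₂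
d k t n j = p (k + t) (t + toℕ j)

ξ : (t : ℕ) → Fin t → Z₂
ξ t j = [ t C toℕ j ]₂

w : (v : ℕ) → (n : ℕ) → Fin n → Z₂
w v n i = ((toℕ i % 8) ≡ᵇ 0) ∧ ((1 ≤ᵇ (toℕ i / 8)) ∧ ((toℕ i / 8) ≤ᵇ v))

-- Over ℤ₂ the operator Σ_b C(t,b) E^b, E the shift k ↦ k + 1, is (1 + E)^t = Δ^t, and Pascal's
-- rule p(i+1, j+1) = p(i, j+1) + p(i+1, j) says Δ p(·, n+1) = p(· + 1, n). Hence
-- Σ_{b≤t} C(t,b) p(k+b, n) is p(k+t, n-t) for n ≥ t and 0 for n < t. Moving the term b = t to
-- the other side, the case n < t is the row identity c_{k+t,t} = ξ_t A_{k,t}, which gives (1);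
-- the case n = t + j says that the j-th entry of d_{k+t,t} - ξ_t B_{k,t} is p(k+t, j). Pairing
-- with w picks the entries j = 8s, 1 ≤ s ≤ v; by Lucas' theorem p(K, 8s) = p(⌊K/8⌋, s), and the
-- hockey-stick identity Σ_{s≤v} p(q, s) = p(q+1, v) evaluates the sum.
module Submission where

open import Defs
open import Algebra.Bundles using (CommutativeRing)
open import Data.Bool using (true; false; not; _xor_; _∧_)
open import Data.Bool.Properties
  using (not-involutive; not-distribˡ-xor; true-xor; xor-comm; xor-assoc; xor-same; xor-identityʳ;
         ∧-zeroʳ; ∧-identityʳ; ∧-assoc; ∧-distribʳ-xor; T-≡; ¬-not; xor-∧-commutativeRing)
open import Data.Fin using (Fin; toℕ; zero; suc)
open import Data.Fin.Properties using (toℕ<n)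
open import Data.Nat using (ℕ; zero; suc; _+_; _*_; _^_; _∸_; _<_; _≤_; _/_; _%_; _≡ᵇ_; _≤ᵇ_; s≤s; s<s)
open import Data.Nat.Combinatorics using (_C_; nCn≡1; k>n⇒nCk≡0; nCk+nC[k+1]≡[n+1]C[k+1])
open import Data.Nat.DivMod
  using (m≡m%n+[m/n]*n; [m+n]%n≡m%n; [m+kn]%n≡m%n; m*n%n≡0; m*n/n≡m; m%n<n; m<n⇒m%n≡m; m/n/o≡m/[n*o]; /-monoˡ-≤)
open import Data.Nat.Properties
  using (+-comm; +-assoc; +-suc; +-identityʳ; m≤n⇒m<n∨m≡n; *-assoc; *-comm; m≤m+n; m+[n∸m]≡n; n<1+n; ≤ᵇ⇒≤; ≤⇒≤ᵇ; <⇒≱)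
open import Data.Product using (_×_; _,_)
open import Data.Sum using (inj₁; inj₂)
open import Function using (Equivalence)
open import Relation.Binary.PropositionalEquality
  using (_≡_; _≗_; refl; sym; trans; cong; cong₂; subst; module ≡-Reasoning)
open ≡-Reasoning

open CommutativeRing xor-∧-commutativeRing using (semiring)
open import Algebra.Properties.Semiring.Sum semiring using (sum; ∑-distrib-+; ∑-comm; *-distribˡ-sum; *-distribʳ-sum)

xor-cancelˡ : ∀ x y → x xor (x xor y) ≡ y
xor-cancelˡ x y = trans (sym (xor-assoc x x y)) (cong (_xor y) (xor-same x))

xor-cancelʳ : ∀ x y → (x xor y) xor y ≡ x
xor-cancelʳ x y = trans (xor-assoc x y y) (trans (cong (x xor_) (xor-same y)) (xor-identityʳ x))

parity : ℕ → Z₂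
parity zero    = false
parity (suc n) = not (parity n)

parity-+ : ∀ m n → parity (m + n) ≡ parity m xor parity n
parity-+ zero    n = refl
parity-+ (suc m) n = trans (cong not (parity-+ m n)) (not-distribˡ-xor (parity m) (parity n))

[]₂≡parity : ∀ n → [ n ]₂ ≡ parity n
[]₂≡parity zero          = refl
[]₂≡parity (suc zero)    = refl
[]₂≡parity (suc (suc n)) = begin
  [ 2 + n ]₂    ≡⟨ cong [_]₂ (+-comm 2 n) ⟩
  [ n + 2 ]₂    ≡⟨ cong (_≡ᵇ 1) ([m+n]%n≡m%n n 2) ⟩
  [ n ]₂        ≡⟨ []₂≡parity n ⟩
  parity n      ≡⟨ sym (not-involutive (parity n)) ⟩
  parity (2 + n) ∎

[]₂-+ : ∀ m n → [ m + n ]₂ ≡ [ m ]₂ xor [ n ]₂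
[]₂-+ m n = trans ([]₂≡parity (m + n))
  (trans (parity-+ m n) (sym (cong₂ _xor_ ([]₂≡parity m) ([]₂≡parity n))))

[]₂-+1 : ∀ n → [ n + 1 ]₂ ≡ not [ n ]₂
[]₂-+1 n = trans ([]₂-+ n 1) (trans (xor-comm [ n ]₂ true) (true-xor [ n ]₂))

-- Binomial coefficients modulo 2

[]₂-pascal : ∀ n k → [ suc n C suc k ]₂ ≡ [ n C k ]₂ xor [ n C suc k ]₂
[]₂-pascal n k = trans (cong [_]₂ (sym (nCk+nC[k+1]≡[n+1]C[k+1] n k))) ([]₂-+ (n C k) (n C suc k))

[]₂-nCn : ∀ n → [ n C n ]₂ ≡ true
[]₂-nCn n = cong [_]₂ (nCn≡1 n)

[]₂-nC[1+n] : ∀ n → [ n C suc n ]₂ ≡ false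
[]₂-nC[1+n] n = cong [_]₂ (k>n⇒nCk≡0 (n<1+n n))

p-zeroˡ : ∀ j → p 0 j ≡ true
p-zeroˡ = []₂-nCn

p-pascal : ∀ i j → p (suc i) (suc j) ≡ p i (suc j) xor p (suc i) j
p-pascal i j = begin
  p (suc i) (suc j)                                  ≡⟨ cong (λ n → [ suc n C suc j ]₂) (+-suc i j) ⟩
  [ suc (suc i + j) C suc j ]₂                       ≡⟨ []₂-pascal (suc i + j) j ⟩
  [ (suc i + j) C j ]₂ xor [ (suc i + j) C suc j ]₂  ≡⟨ xor-comm [ (suc i + j) C j ]₂ _ ⟩
  [ (suc i + j) C suc j ]₂ xor p (suc i) j           ≡⟨ cong (λ n → [ n C suc j ]₂ xor p (suc i) j) (sym (+-suc i j)) ⟩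
  p i (suc j) xor p (suc i) j                        ∎

Σ₂≡sum : ∀ n (f : Fin n → Z₂) → Σ₂ n f ≡ sum f
Σ₂≡sum zero    f = refl
Σ₂≡sum (suc n) f = cong (f zero xor_) (Σ₂≡sum n (λ i → f (suc i)))

Σ₂-cong : ∀ n {f g : Fin n → Z₂} → f ≗ g → Σ₂ n f ≡ Σ₂ n g
Σ₂-cong zero    f≗g = refl
Σ₂-cong (suc n) f≗g = cong₂ _xor_ (f≗g zero) (Σ₂-cong n (λ i → f≗g (suc i)))

Σ₂-false : ∀ n {f : Fin n → Z₂} → (∀ i → f i ≡ false) → Σ₂ n f ≡ false
Σ₂-false zero    f≡false = refl
Σ₂-false (suc n) f≡false = cong₂ _xor_ (f≡false zero) (Σ₂-false n (λ i → f≡false (suc i)))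

Σ₂-distrib-xor : ∀ n (f g : Fin n → Z₂) → Σ₂ n (λ i → f i xor g i) ≡ Σ₂ n f xor Σ₂ n g
Σ₂-distrib-xor n f g = begin
  Σ₂ n (λ i → f i xor g i)  ≡⟨ Σ₂≡sum n _ ⟩
  sum (λ i → f i xor g i)   ≡⟨ ∑-distrib-+ f g ⟩
  sum f xor sum g           ≡⟨ sym (cong₂ _xor_ (Σ₂≡sum n f) (Σ₂≡sum n g)) ⟩
  Σ₂ n f xor Σ₂ n g         ∎

∧-distribˡ-Σ₂ : ∀ n x (f : Fin n → Z₂) → x ∧ Σ₂ n f ≡ Σ₂ n (λ i → x ∧ f i)
∧-distribˡ-Σ₂ n x f =
  trans (cong (x ∧_) (Σ₂≡sum n f)) (trans (*-distribˡ-sum x f) (sym (Σ₂≡sum n _)))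

∧-distribʳ-Σ₂ : ∀ n x (f : Fin n → Z₂) → Σ₂ n f ∧ x ≡ Σ₂ n (λ i → f i ∧ x)
∧-distribʳ-Σ₂ n x f =
  trans (cong (_∧ x) (Σ₂≡sum n f)) (trans (*-distribʳ-sum x f) (sym (Σ₂≡sum n _)))

Σ₂-comm : ∀ m n (f : Fin m → Fin n → Z₂) →
          Σ₂ m (λ i → Σ₂ n (f i)) ≡ Σ₂ n (λ j → Σ₂ m (λ i → f i j))
Σ₂-comm m n f = trans (as-sum m n f) (trans (∑-comm f) (sym (as-sum n m (λ j i → f i j))))
  where
  as-sum : ∀ m n (f : Fin m → Fin n → Z₂) → Σ₂ m (λ i → Σ₂ n (f i)) ≡ sum (λ i → sum (f i))
  as-sum m n f = trans (Σ₂-cong m (λ i → Σ₂≡sum n (f i))) (Σ₂≡sum m _)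

Σℕ : ℕ → (ℕ → Z₂) → Z₂
Σℕ n f = Σ₂ n (λ i → f (toℕ i))

Σℕ-cong : ∀ n {f g : ℕ → Z₂} → (∀ i → i < n → f i ≡ g i) → Σℕ n f ≡ Σℕ n g
Σℕ-cong n f≡g = Σ₂-cong n (λ i → f≡g (toℕ i) (toℕ<n i))

Σℕ-false : ∀ n {f : ℕ → Z₂} → (∀ i → i < n → f i ≡ false) → Σℕ n f ≡ false
Σℕ-false n f≡false = Σ₂-false n (λ i → f≡false (toℕ i) (toℕ<n i))

Σℕ-distrib-xor : ∀ n (f g : ℕ → Z₂) → Σℕ n (λ i → f i xor g i) ≡ Σℕ n f xor Σℕ n g
Σℕ-distrib-xor n f g = Σ₂-distrib-xor n (λ i → f (toℕ i)) (λ i → g (toℕ i))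

Σℕ-sucʳ : ∀ n (f : ℕ → Z₂) → Σℕ (suc n) f ≡ Σℕ n f xor f n
Σℕ-sucʳ zero    f = xor-comm (f 0) false
Σℕ-sucʳ (suc n) f = trans (cong (f 0 xor_) (Σℕ-sucʳ n (λ i → f (suc i)))) (sym (xor-assoc (f 0) _ _))

Σℕ-+ : ∀ m n (f : ℕ → Z₂) → Σℕ (m + n) f ≡ Σℕ m f xor Σℕ n (λ i → f (m + i))
Σℕ-+ zero    n f = refl
Σℕ-+ (suc m) n f = trans (cong (f 0 xor_) (Σℕ-+ m n (λ i → f (suc i)))) (sym (xor-assoc (f 0) _ _))

Σℕ-prefix : ∀ {m n} (f : ℕ → Z₂) → m ≤ n → (∀ i → m ≤ i → f i ≡ false) → Σℕ n f ≡ Σℕ m f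
Σℕ-prefix {m} {n} f m≤n f≡false = begin
  Σℕ n f                                          ≡⟨ cong (λ l → Σℕ l f) (sym (m+[n∸m]≡n m≤n)) ⟩
  Σℕ (m + (n ∸ m)) f                              ≡⟨ Σℕ-+ m (n ∸ m) f ⟩
  Σℕ m f xor Σℕ (n ∸ m) (λ i → f (m + i))         ≡⟨ cong (Σℕ m f xor_) (Σℕ-false (n ∸ m) (λ i _ → f≡false (m + i) (m≤m+n m i))) ⟩
  Σℕ m f xor false                                ≡⟨ xor-identityʳ (Σℕ m f) ⟩
  Σℕ m f                                          ∎

Σℕ-multiples : ∀ d u (g : ℕ → Z₂) → (∀ s r → r < d → g (s * suc d + suc r) ≡ false) →
               Σℕ (u * suc d) g ≡ Σℕ u (λ s → g (s * suc d))
Σℕ-multiples d zero    g off = refl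
Σℕ-multiples d (suc u) g off = begin
  Σℕ (suc d + u * suc d) g                                 ≡⟨ Σℕ-+ (suc d) (u * suc d) g ⟩
  Σℕ (suc d) g xor Σℕ (u * suc d) (λ i → g (suc d + i))    ≡⟨ cong₂ _xor_ first-block (Σℕ-multiples d u (λ i → g (suc d + i)) shifted-off) ⟩
  (g 0 xor false) xor Σℕ u (λ s → g (suc d + s * suc d))   ≡⟨ cong (_xor Σℕ u (λ s → g (suc d + s * suc d))) (xor-identityʳ (g 0)) ⟩
  Σℕ (suc u) (λ s → g (s * suc d))                         ∎
  where
  first-block : Σℕ (suc d) g ≡ g 0 xor false
  first-block = cong (g 0 xor_) (Σℕ-false d (off 0))
  shifted-off : ∀ s r → r < d → g (suc d + (s * suc d + suc r)) ≡ false
  shifted-off s r r<d = trans (cong g (sym (+-assoc (suc d) (s * suc d) (suc r)))) (off (suc s) r r<d)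

infixl 7 _⊙_

_⊙_ : ∀ {r s} → (Fin r → Z₂) → (Fin r → Fin s → Z₂) → Fin s → Z₂
_⊙_ {r} x M j = Σ₂ r (λ a → x a ∧ M a j)

⊙-congˡ : ∀ {r s} {x y : Fin r → Z₂} (M : Fin r → Fin s → Z₂) → x ≗ y → x ⊙ M ≗ y ⊙ M
⊙-congˡ {r} M x≗y j = Σ₂-cong r (λ a → cong (_∧ M a j) (x≗y a))

⊙-assoc : ∀ {r s u} (x : Fin r → Z₂) (M : Fin r → Fin s → Z₂) (N : Fin s → Fin u → Z₂) →
          (x ⊙ M) ⊙ N ≗ x ⊙ (M ⊗ N)
⊙-assoc {r} {s} x M N j = begin
  Σ₂ s (λ b → Σ₂ r (λ a → x a ∧ M a b) ∧ N b j)      ≡⟨ Σ₂-cong s (λ b → ∧-distribʳ-Σ₂ r (N b j) _) ⟩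
  Σ₂ s (λ b → Σ₂ r (λ a → (x a ∧ M a b) ∧ N b j))    ≡⟨ Σ₂-comm s r _ ⟩
  Σ₂ r (λ a → Σ₂ s (λ b → (x a ∧ M a b) ∧ N b j))    ≡⟨ Σ₂-cong r (λ a → Σ₂-cong s (λ b → ∧-assoc (x a) (M a b) (N b j))) ⟩
  Σ₂ r (λ a → Σ₂ s (λ b → x a ∧ (M a b ∧ N b j)))    ≡⟨ Σ₂-cong r (λ a → sym (∧-distribˡ-Σ₂ s (x a) _)) ⟩
  (x ⊙ (M ⊗ N)) j                                    ∎

⊙-identityʳ : ∀ n (x : Fin n → Z₂) → x ⊙ I n ≗ x
⊙-identityʳ (suc n) x zero = begin
  (x zero ∧ true) xor Σ₂ n (λ b → x (suc b) ∧ false)  ≡⟨ cong ((x zero ∧ true) xor_) (Σ₂-false n (λ b → ∧-zeroʳ (x (suc b)))) ⟩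
  (x zero ∧ true) xor false                           ≡⟨ xor-identityʳ _ ⟩
  x zero ∧ true                                       ≡⟨ ∧-identityʳ (x zero) ⟩
  x zero                                              ∎
⊙-identityʳ (suc n) x (suc j) =
  trans (cong (_xor Σ₂ n (λ b → x (suc b) ∧ I n b j)) (∧-zeroʳ (x zero))) (⊙-identityʳ n (λ b → x (suc b)) j)

⊙-rightInverse : ∀ {r s} (x : Fin r → Z₂) (M : Fin r → Fin s → Z₂) (N : Fin s → Fin r → Z₂) →
                 (∀ i j → (M ⊗ N) i j ≡ I r i j) → (x ⊙ M) ⊙ N ≗ x
⊙-rightInverse {r} x M N M⊗N≡I j =
  trans (⊙-assoc x M N j) (trans (Σ₂-cong r (λ a → cong (x a ∧_) (M⊗N≡I a j))) (⊙-identityʳ r x j))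

-- The binomial transform (1 + E)ᵗ

Δ^ : ℕ → (ℕ → Z₂) → ℕ → Z₂
Δ^ t f k = Σℕ (suc t) (λ b → [ t C b ]₂ ∧ f (k + b))

Δ^-suc : ∀ t f k → Δ^ (suc t) f k ≡ Δ^ t f k xor Δ^ t f (suc k)
Δ^-suc t f k = begin
  Δ^ (suc t) f k
    ≡⟨⟩
  f (k + 0) xor Σℕ (suc t) (λ b → [ suc t C suc b ]₂ ∧ f (k + suc b))
    ≡⟨ cong (f (k + 0) xor_) (Σℕ-cong (suc t) (λ b _ → pascal b)) ⟩
  f (k + 0) xor Σℕ (suc t) (λ b → α b xor β b)
    ≡⟨ cong (f (k + 0) xor_) (Σℕ-distrib-xor (suc t) α β) ⟩
  f (k + 0) xor (Σℕ (suc t) α xor Σℕ (suc t) β)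
    ≡⟨ cong (f (k + 0) xor_) (xor-comm (Σℕ (suc t) α) _) ⟩
  f (k + 0) xor (Σℕ (suc t) β xor Σℕ (suc t) α)
    ≡⟨ sym (xor-assoc (f (k + 0)) _ _) ⟩
  Σℕ (suc (suc t)) χ xor Δ^ t f (suc k)
    ≡⟨ cong (_xor Δ^ t f (suc k)) (Σℕ-sucʳ (suc t) χ) ⟩
  (Δ^ t f k xor χ (suc t)) xor Δ^ t f (suc k)
    ≡⟨ cong (λ z → (Δ^ t f k xor (z ∧ f (k + suc t))) xor Δ^ t f (suc k)) ([]₂-nC[1+n] t) ⟩
  (Δ^ t f k xor false) xor Δ^ t f (suc k)
    ≡⟨ cong (_xor Δ^ t f (suc k)) (xor-identityʳ (Δ^ t f k)) ⟩
  Δ^ t f k xor Δ^ t f (suc k)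
    ∎
  where
  α β χ : ℕ → Z₂
  α b = [ t C b ]₂ ∧ f (suc k + b)
  β b = [ t C suc b ]₂ ∧ f (k + suc b)
  χ b = [ t C b ]₂ ∧ f (k + b)
  pascal : ∀ b → [ suc t C suc b ]₂ ∧ f (k + suc b) ≡ α b xor β b
  pascal b = begin
    [ suc t C suc b ]₂ ∧ f (k + suc b)                              ≡⟨ cong (_∧ f (k + suc b)) ([]₂-pascal t b) ⟩
    ([ t C b ]₂ xor [ t C suc b ]₂) ∧ f (k + suc b)                 ≡⟨ ∧-distribʳ-xor (f (k + suc b)) [ t C b ]₂ _ ⟩
    ([ t C b ]₂ ∧ f (k + suc b)) xor β b                            ≡⟨ cong (λ n → ([ t C b ]₂ ∧ f n) xor β b) (+-suc k b) ⟩
    α b xor β b                                                     ∎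

Σℕ-binomial : ∀ t f k → Σℕ t (λ b → [ t C b ]₂ ∧ f (k + b)) ≡ Δ^ t f k xor f (k + t)
Σℕ-binomial t f k = sym (trans (cong (_xor f (k + t)) Δ^-last) (xor-cancelʳ _ (f (k + t))))
  where
  Δ^-last : Δ^ t f k ≡ Σℕ t (λ b → [ t C b ]₂ ∧ f (k + b)) xor f (k + t)
  Δ^-last = trans (Σℕ-sucʳ t χ) (cong (λ z → Σℕ t χ xor (z ∧ f (k + t))) ([]₂-nCn t))
    where
    χ : ℕ → Z₂
    χ b = [ t C b ]₂ ∧ f (k + b)

Δ^-p-shift : ∀ t k j → Δ^ t (λ i → p i (t + j)) k ≡ p (k + t) j
Δ^-p-shift zero    k j = xor-identityʳ (p (k + 0) j)
Δ^-p-shift (suc t) k j = begin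
  Δ^ (suc t) (λ i → p i (suc t + j)) k
    ≡⟨ Δ^-suc t (λ i → p i (suc t + j)) k ⟩
  Δ^ t (λ i → p i (suc t + j)) k xor Δ^ t (λ i → p i (suc t + j)) (suc k)
    ≡⟨ cong (λ n → Δ^ t (λ i → p i n) k xor Δ^ t (λ i → p i n) (suc k)) (sym (+-suc t j)) ⟩
  Δ^ t (λ i → p i (t + suc j)) k xor Δ^ t (λ i → p i (t + suc j)) (suc k)
    ≡⟨ cong₂ _xor_ (Δ^-p-shift t k (suc j)) (Δ^-p-shift t (suc k) (suc j)) ⟩
  p (k + t) (suc j) xor p (suc (k + t)) (suc j)
    ≡⟨ cong (p (k + t) (suc j) xor_) (p-pascal (k + t) j) ⟩
  p (k + t) (suc j) xor (p (k + t) (suc j) xor p (suc (k + t)) j)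
    ≡⟨ xor-cancelˡ (p (k + t) (suc j)) _ ⟩
  p (suc (k + t)) j
    ≡⟨ cong (λ n → p n j) (sym (+-suc k t)) ⟩
  p (k + suc t) j
    ∎

Δ^-p-vanish : ∀ t k n → n < t → Δ^ t (λ i → p i n) k ≡ false
Δ^-p-vanish (suc t) k n (s≤s n≤t) with m≤n⇒m<n∨m≡n n≤t
... | inj₁ n<t  = trans (Δ^-suc t (λ i → p i n) k) (cong₂ _xor_ (Δ^-p-vanish t k n n<t) (Δ^-p-vanish t (suc k) n n<t))
... | inj₂ refl = trans (Δ^-suc t (λ i → p i n) k) (cong₂ _xor_ (Δ^-p-top k) (Δ^-p-top (suc k)))
  where
  Δ^-p-top : ∀ k′ → Δ^ n (λ i → p i n) k′ ≡ true
  Δ^-p-top k′ = trans (cong (λ l → Δ^ n (λ i → p i l) k′) (sym (+-identityʳ n))) (Δ^-p-shift n k′ 0)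

c≗ξ⊙A : ∀ k t → c k t ≗ ξ t ⊙ A k t
c≗ξ⊙A k t a = sym (begin
  Σℕ t (λ b → [ t C b ]₂ ∧ p (k + b) (toℕ a))  ≡⟨ Σℕ-binomial t (λ i → p i (toℕ a)) k ⟩
  Δ^ t (λ i → p i (toℕ a)) k xor c k t a       ≡⟨ cong (_xor c k t a) (Δ^-p-vanish t k (toℕ a) (toℕ<n a)) ⟩
  c k t a                                      ∎)

d-ξ⊙B : ∀ k t n (j : Fin n) → d k t n j xor (ξ t ⊙ B k t n) j ≡ p (k + t) (toℕ j)
d-ξ⊙B k t n j = begin
  d k t n j xor Σℕ t (λ b → [ t C b ]₂ ∧ p (k + b) (t + toℕ j))  ≡⟨ cong (d k t n j xor_) (Σℕ-binomial t (λ i → p i (t + toℕ j)) k) ⟩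
  d k t n j xor (Δ^ t (λ i → p i (t + toℕ j)) k xor d k t n j)   ≡⟨ cong (λ z → d k t n j xor (z xor d k t n j)) (Δ^-p-shift t k (toℕ j)) ⟩
  d k t n j xor (p (k + t) (toℕ j) xor d k t n j)                ≡⟨ cong (d k t n j xor_) (xor-comm (p (k + t) (toℕ j)) _) ⟩
  d k t n j xor (d k t n j xor p (k + t) (toℕ j))                ≡⟨ xor-cancelˡ (d k t n j) _ ⟩
  p (k + t) (toℕ j)                                              ∎

-- Lucas' theorem for the prime 2

p-one-even : ∀ b → p 1 (b * 2) ≡ true
p-one-even zero    = refl
p-one-even (suc b) = begin
  p 1 (2 + b * 2)                           ≡⟨ p-pascal 0 (suc (b * 2)) ⟩
  p 0 (2 + b * 2) xor p 1 (1 + b * 2)       ≡⟨ cong₂ _xor_ (p-zeroˡ (2 + b * 2)) (p-pascal 0 (b * 2)) ⟩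
  true xor (p 0 (1 + b * 2) xor p 1 (b * 2)) ≡⟨ cong (λ z → true xor (z xor p 1 (b * 2))) (p-zeroˡ (1 + b * 2)) ⟩
  true xor (true xor p 1 (b * 2))           ≡⟨ xor-cancelˡ true (p 1 (b * 2)) ⟩
  p 1 (b * 2)                               ≡⟨ p-one-even b ⟩
  true                                      ∎

p-lucas : ∀ r → r < 2 → ∀ a b → p (a * 2 + r) (b * 2) ≡ p a b
p-lucas r          r<2 a    zero    = refl
p-lucas zero       r<2 zero (suc b) = trans (p-zeroˡ (suc b * 2)) (sym (p-zeroˡ (suc b)))
p-lucas (suc zero) r<2 zero (suc b) = trans (p-one-even (suc b)) (sym (p-zeroˡ (suc b)))
p-lucas (suc (suc r)) (s<s (s<s ())) zero (suc b)
p-lucas r          r<2 (suc a) (suc b) = begin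
  p (suc (suc i)) (suc (suc j))
    ≡⟨ p-pascal (suc i) (suc j) ⟩
  p (suc i) (suc (suc j)) xor p (suc (suc i)) (suc j)
    ≡⟨ cong₂ _xor_ (p-pascal i (suc j)) (p-pascal (suc i) j) ⟩
  (p i (suc (suc j)) xor p (suc i) (suc j)) xor (p (suc i) (suc j) xor p (suc (suc i)) j)
    ≡⟨ xor-assoc (p i (suc (suc j))) _ _ ⟩
  p i (suc (suc j)) xor (p (suc i) (suc j) xor (p (suc i) (suc j) xor p (suc (suc i)) j))
    ≡⟨ cong (p i (suc (suc j)) xor_) (xor-cancelˡ (p (suc i) (suc j)) _) ⟩
  p i (suc (suc j)) xor p (suc (suc i)) j
    ≡⟨ cong₂ _xor_ (p-lucas r r<2 a (suc b)) (p-lucas r r<2 (suc a) b) ⟩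
  p a (suc b) xor p (suc a) b
    ≡⟨ sym (p-pascal a b) ⟩
  p (suc a) (suc b)
    ∎
  where
  i = a * 2 + r
  j = b * 2

p-halve : ∀ K b → p K (b * 2) ≡ p (K / 2) b
p-halve K b = trans (cong (λ n → p n (b * 2)) (trans (m≡m%n+[m/n]*n K 2) (+-comm (K % 2) _)))
  (p-lucas (K % 2) (m%n<n K 2) (K / 2) b)

p-eighth : ∀ K s → p K (s * 8) ≡ p (K / 8) s
p-eighth K s = begin
  p K (s * 8)                ≡⟨ cong (p K) (sym (*-assoc s 4 2)) ⟩
  p K (s * 4 * 2)            ≡⟨ p-halve K (s * 4) ⟩
  p (K / 2) (s * 4)          ≡⟨ cong (p (K / 2)) (sym (*-assoc s 2 2)) ⟩
  p (K / 2) (s * 2 * 2)      ≡⟨ p-halve (K / 2) (s * 2) ⟩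
  p (K / 2 / 2) (s * 2)      ≡⟨ p-halve (K / 2 / 2) s ⟩
  p (K / 2 / 2 / 2) s        ≡⟨ cong (λ n → p n s) (trans (m/n/o≡m/[n*o] (K / 2) 2 2) (m/n/o≡m/[n*o] K 2 4)) ⟩
  p (K / 8) s                ∎

Σℕ-p-hockeyStick : ∀ q u → Σℕ (suc u) (p q) ≡ p (suc q) u
Σℕ-p-hockeyStick q zero    = refl
Σℕ-p-hockeyStick q (suc u) = begin
  Σℕ (suc (suc u)) (p q)          ≡⟨ Σℕ-sucʳ (suc u) (p q) ⟩
  Σℕ (suc u) (p q) xor p q (suc u) ≡⟨ cong (_xor p q (suc u)) (Σℕ-p-hockeyStick q u) ⟩
  p (suc q) u xor p q (suc u)      ≡⟨ xor-comm (p (suc q) u) _ ⟩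
  p q (suc u) xor p (suc q) u      ≡⟨ sym (p-pascal q u) ⟩
  p (suc q) (suc u)                ∎

-- w v n i reduces to wℕ v (toℕ i).
wℕ : ℕ → ℕ → Z₂
wℕ v j = ((j % 8) ≡ᵇ 0) ∧ ((1 ≤ᵇ (j / 8)) ∧ ((j / 8) ≤ᵇ v))

≤ᵇ-true : ∀ {m n} → m ≤ n → (m ≤ᵇ n) ≡ true
≤ᵇ-true m≤n = Equivalence.to T-≡ (≤⇒≤ᵇ m≤n)

≤ᵇ-false : ∀ {m n} → n < m → (m ≤ᵇ n) ≡ false
≤ᵇ-false {m} {n} n<m = ¬-not (λ m≤ᵇn → <⇒≱ n<m (≤ᵇ⇒≤ m n (Equivalence.from T-≡ m≤ᵇn)))

wℕ-multiple : ∀ v s → wℕ v (s * 8) ≡ (1 ≤ᵇ s) ∧ (s ≤ᵇ v)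
wℕ-multiple v s = cong₂ (λ x y → (x ≡ᵇ 0) ∧ ((1 ≤ᵇ y) ∧ (y ≤ᵇ v))) (m*n%n≡0 s 8) (m*n/n≡m s 8)

wℕ-nonMultiple : ∀ v s r → r < 7 → wℕ v (s * 8 + suc r) ≡ false
wℕ-nonMultiple v s r r<7 = cong (λ x → (x ≡ᵇ 0) ∧ ((1 ≤ᵇ (j / 8)) ∧ ((j / 8) ≤ᵇ v))) j%8≡1+r
  where
  j = s * 8 + suc r
  j%8≡1+r : j % 8 ≡ suc r
  j%8≡1+r = trans (cong (_% 8) (+-comm (s * 8) (suc r))) (trans ([m+kn]%n≡m%n (suc r) s 8) (m<n⇒m%n≡m (s<s r<7)))

wℕ-beyond : ∀ v j → suc v * 8 ≤ j → wℕ v j ≡ false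
wℕ-beyond v j le = trans (cong (λ b → ((j % 8) ≡ᵇ 0) ∧ ((1 ≤ᵇ (j / 8)) ∧ b)) (≤ᵇ-false v<j/8))
  (trans (cong (((j % 8) ≡ᵇ 0) ∧_) (∧-zeroʳ (1 ≤ᵇ (j / 8)))) (∧-zeroʳ ((j % 8) ≡ᵇ 0)))
  where
  v<j/8 : v < j / 8
  v<j/8 = subst (_≤ j / 8) (m*n/n≡m (suc v) 8) (/-monoˡ-≤ 8 le)

Σℕ-p∧wℕ : ∀ K v N → 8 * (v + 1) ≤ N → Σℕ N (λ j → p K j ∧ wℕ v j) ≡ not (p (suc (K / 8)) v)
Σℕ-p∧wℕ K v N 8[v+1]≤N = begin
  Σℕ N g
    ≡⟨ Σℕ-prefix g [1+v]*8≤N (λ j le → vanish j (wℕ-beyond v j le)) ⟩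
  Σℕ (suc v * 8) g
    ≡⟨ Σℕ-multiples 7 (suc v) g (λ s r r<7 → vanish (s * 8 + suc r) (wℕ-nonMultiple v s r r<7)) ⟩
  Σℕ (suc v) (λ s → g (s * 8))
    ≡⟨ Σℕ-cong (suc v) (λ s _ → cong₂ _∧_ (p-eighth K s) (wℕ-multiple v s)) ⟩
  Σℕ (suc v) (λ s → p q s ∧ ((1 ≤ᵇ s) ∧ (s ≤ᵇ v)))
    ≡⟨ Σℕ-cong v (λ s s<v → trans (cong (p q (suc s) ∧_) (≤ᵇ-true s<v)) (∧-identityʳ _)) ⟩  -- the term s = 0 is false
  Σℕ v (λ s → p q (suc s))
    ≡⟨ sym (not-involutive _) ⟩
  not (true xor Σℕ v (λ s → p q (suc s)))
    ≡⟨ cong not (Σℕ-p-hockeyStick q v) ⟩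
  not (p (suc q) v)
    ∎
  where
  q = K / 8
  g : ℕ → Z₂
  g j = p K j ∧ wℕ v j
  vanish : ∀ j → wℕ v j ≡ false → g j ≡ false
  vanish j w≡false = trans (cong (p K j ∧_) w≡false) (∧-zeroʳ (p K j))
  [1+v]*8≤N : suc v * 8 ≤ N
  [1+v]*8≤N = subst (_≤ N) (trans (*-comm 8 (v + 1)) (cong (_* 8) (+-comm v 1))) 8[v+1]≤N

proposition1 : (m k t : ℕ) → 0 < m → 0 < t → k + t < 2 ^ m →
    (Ainv : Fin t → Fin t → Z₂) →
    (∀ i j → (Ainv ⊗ A k t) i j ≡ I t i j) →
    (∀ i j → (A k t ⊗ Ainv) i j ≡ I t i j) →
    (∀ j → Σ₂ t (λ a → c k t a ∧ Ainv a j) ≡ ξ t j)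
    × (∀ v → 8 * (v + 1) ≤ 2 ^ m ∸ t →
        Σ₂ (2 ^ m ∸ t)
          (λ j → (d k t (2 ^ m ∸ t) j
                   xor Σ₂ t (λ b → Σ₂ t (λ a → c k t a ∧ Ainv a b) ∧ B k t (2 ^ m ∸ t) b j))
                 ∧ w v (2 ^ m ∸ t) j)
        ≡ [ (((k + t) / 8 + 1 + v) C v) + 1 ]₂)
proposition1 m k t _ _ _ Ainv _ A⊗Ainv≡I = κ≗ξ , part2
  where
  N = 2 ^ m ∸ t
  κ≗ξ : c k t ⊙ Ainv ≗ ξ t
  κ≗ξ j = trans (⊙-congˡ Ainv (c≗ξ⊙A k t) j) (⊙-rightInverse (ξ t) (A k t) Ainv A⊗Ainv≡I j)
  part2 : ∀ v → 8 * (v + 1) ≤ N →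
          Σ₂ N (λ j → (d k t N j xor (c k t ⊙ Ainv ⊙ B k t N) j) ∧ w v N j) ≡ [ (((k + t) / 8 + 1 + v) C v) + 1 ]₂
  part2 v 8[v+1]≤N = begin
    Σ₂ N (λ j → (d k t N j xor (c k t ⊙ Ainv ⊙ B k t N) j) ∧ w v N j)
      ≡⟨ Σ₂-cong N (λ j → cong (λ x → (d k t N j xor x) ∧ w v N j) (⊙-congˡ (B k t N) κ≗ξ j)) ⟩
    Σ₂ N (λ j → (d k t N j xor (ξ t ⊙ B k t N) j) ∧ w v N j)
      ≡⟨ Σ₂-cong N (λ j → cong (_∧ w v N j) (d-ξ⊙B k t N j)) ⟩
    Σℕ N (λ j → p (k + t) j ∧ wℕ v j)      ≡⟨ Σℕ-p∧wℕ (k + t) v N 8[v+1]≤N ⟩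
    not (p (suc ((k + t) / 8)) v)          ≡⟨ cong (λ n → not [ (n + v) C v ]₂) (+-comm 1 ((k + t) / 8)) ⟩
    not [ ((k + t) / 8 + 1 + v) C v ]₂     ≡⟨ sym ([]₂-+1 (((k + t) / 8 + 1 + v) C v)) ⟩
    [ (((k + t) / 8 + 1 + v) C v) + 1 ]₂   ∎
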